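{- Let $r,s$ be positive integers and $k$ a positive integer divisible by $r+s$. Let $\alpha\ge0$ be a good shift (for $r,s,k$), let $a=k+\alpha$, and define $f:\{0,1,\ldots,a-1\}\to\{ -r,s\}$ by $f(j)=-r$ if $j<\frac{sk}{r+s}-1$ and $f(j)=s$ if $j\ge\frac{sk}{r+s}-1$. Then: (1) the number of $j$ with $f(j)=-r$ is $\frac{sk}{r+s}-1$ and the number with $f(j)=s$ is $\frac{rk}{r+s}+1+\alpha$; (2) if $A\subseteq\mathbb Z$ is an $a$-term arithmetic progression and $S$ is the multiset of residues modulo $a$ (in $\{0,\ldots,a-1\}$) of its terms, then $\sum_{j\in S}f(j)\notin\mathcal S_\alpha$ (sum counting multiplicity); (3) if $B\subseteq\mathbb Z$ is a $k$-term arithmetic progression and $T$ is the multiset of residues modulo $a$ of its terms, then $\sum_{j\in T}f(j)\ne0$ (sum counting multiplicity).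
   Context: For a nonnegative integer $\alpha$, $\mathcal S_\alpha=\{ -r\alpha,-r(\alpha-1)+s,-r(\alpha-2)+2s,\ldots,s\alpha\}$, the set of all possible sums of $\alpha$ numbers each equal to $-r$ or $s$. Given $k$ divisible by $r+s$, a nonnegative integer $\alpha$ is a good shift if no prime factor of $k+\alpha$ divides any element of $\mathcal S_\alpha$ (with the convention that every positive integer divides $0$). -}

module Defs where

open import Data.Nat as ℕ using (ℕ; zero; suc; NonZero; _≤_; _<_; _<?_)
open import Data.Nat.Primality using (Prime)
open import Data.Integer as ℤ using (ℤ; +_; -_; _%ℕ_)
open import Data.Integer.Divisibility as ℤd using ()
open import Data.List using (List; map; foldr; upTo; length; filter)
open import Relation.Nullary using (¬_; Dec; yes; no)

sumℤ : List ℤ → ℤ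
sumℤ = foldr ℤ._+_ (+ 0)

InS : (r s α : ℕ) → ℤ → Set
InS r s α n = Data.Product.Σ ℕ (λ i → i ≤ α Data.Product.× n Relation.Binary.PropositionalEquality.≡ (ℤ.- (+ (r ℕ.* (α ℕ.∸ i))) ℤ.+ + (s ℕ.* i)))
  where import Data.Product; import Relation.Binary.PropositionalEquality

-- α is a good shift (for r, s, k): no prime factor of k+α divides any element
-- of 𝒮_α (integer divisibility; every positive integer divides 0)
GoodShift : (r s k α : ℕ) → Set
GoodShift r s k α = ∀ p → Prime p → p ℕd.∣ (k ℕ.+ α) → ∀ n → InS r s α n → ¬ ((+ p) ℤd.∣ n)
  where import Data.Nat.Divisibility as ℕd

nz+ : (r s : ℕ) → .{{NonZero r}} → NonZero (r ℕ.+ s)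
nz+ (suc r) s = _

thr : (r s k : ℕ) → .{{NonZero r}} → ℕ
thr r s k = ℕ._/_ (s ℕ.* k) (r ℕ.+ s) {{nz+ r s}}

-- f(j) = -r if j < sk/(r+s) - 1 (equivalently j + 1 < sk/(r+s)), else s
f : (r s k : ℕ) → .{{NonZero r}} → ℕ → ℤ
f r s k j with suc j <? thr r s k
... | yes _ = ℤ.- (+ r)
... | no  _ = + s

countF : (r s k a : ℕ) → .{{NonZero r}} → ℤ → ℕ
countF r s k a v = length (filter (λ j → f r s k j ℤ.≟ v) (upTo a))

res : ℤ → (a : ℕ) → .{{NonZero a}} → ℕ
res x a = x %ℕ a

apSum : (r s k : ℕ) → .{{NonZero r}} → (a : ℕ) → .{{NonZero a}} → (n : ℕ) → (x d : ℤ) → ℤ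
apSum r s k a n x d = sumℤ (map (λ i → f r s k (res (x ℤ.+ (+ i) ℤ.* d) a)) (upTo n))

module Submission where

-- Over a full period 0, …, a - 1 the values of f sum to r + s + sα, which exceeds
-- max 𝒮_α = sα.  An a-term progression with difference d either meets every residue
-- class once (gcd (a, d) = 1), and then has that same sum, or, for a prime p dividing
-- both a and d, repeats with period a / p, so that p divides its sum; since p ∣ k + α,
-- a good shift keeps such a sum out of 𝒮_α.  A k-term progression with sum 0 extends to
-- an a-term one whose sum is a sum of α values in {-r, s}, i.e. an element of 𝒮_α.

open import Data.Empty using (⊥-elim)
open import Data.Fin using (Fin; toℕ; fromℕ<; punchOut)
import Data.Fin.Properties as FinP
open import Data.Fin.Permutation using (Permutation; permutation)
open import Data.Integer as ℤ using (ℤ; +_; -_; _+_; _*_; _-_; _%ℕ_)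
open import Data.Integer.DivMod using (_/ℕ_; a≡a%ℕn+[a/ℕn]*n; n%ℕd<d)
import Data.Integer.Divisibility.Signed as ℤ∣
import Data.Integer.Properties as ℤP
open import Algebra.Properties.CommutativeMonoid.Sum ℤP.+-0-commutativeMonoid using (sum; sum-permute; sum-cong-≗)
open import Data.Integer.Tactic.RingSolver using (solve-∀)
open import Data.List using ([]; _∷_; map; upTo; applyUpTo; filter; length)
import Data.List.Properties as LP
open import Data.List.Relation.Unary.All using (_∷_)
open import Data.List.Relation.Unary.All.Properties using (applyUpTo⁺₂)
open import Data.Nat as ℕ using (ℕ; NonZero; zero; suc; z≤n; s≤s)
open import Data.Nat.Coprimality using (Coprime; coprime?; coprime-divisor; gcd≡1⇒coprime)
import Data.Nat.DivMod as ℕDM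
open import Data.Nat.Divisibility using (_∣_)
import Data.Nat.Divisibility as ℕ∣
open import Data.Nat.GCD using (gcd; gcd[m,n]∣m; gcd[m,n]∣n; gcd[m,n]≢0)
open import Data.Nat.ListAction using (product)
open import Data.Nat.Primality using (Prime)
open import Data.Nat.Primality.Factorisation using (factorise)
import Data.Nat.Properties as ℕP
import Data.Nat.Tactic.RingSolver as ℕ-Solver
open import Data.Product using (_×_; _,_; proj₁; proj₂; ∃)
open import Data.Sum using (_⊎_; inj₁; inj₂)
open import Function using (_∘_; id)
open import Function.Definitions using (Injective)
open import Relation.Binary.PropositionalEquality using (_≡_; _≢_; refl; sym; trans; cong; cong₂; subst; module ≡-Reasoning)
open import Relation.Nullary using (¬_; yes; no)
open import Relation.Unary using (Decidable)

open import Defs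

sumUpTo : ℕ → (ℕ → ℤ) → ℤ
sumUpTo zero    h = + 0
sumUpTo (suc n) h = h 0 + sumUpTo n (h ∘ suc)

sumℤ-map-upTo : ∀ n (h : ℕ → ℤ) → sumℤ (map h (upTo n)) ≡ sumUpTo n h
sumℤ-map-upTo n h = trans (cong sumℤ (LP.map-upTo h n)) (go n h)
  where
  go : ∀ n (h : ℕ → ℤ) → sumℤ (applyUpTo h n) ≡ sumUpTo n h
  go zero    h = refl
  go (suc n) h = cong (λ t → h 0 + t) (go n (h ∘ suc))

sumUpTo-cong : ∀ n {h h′ : ℕ → ℤ} → (∀ {i} → i ℕ.< n → h i ≡ h′ i) → sumUpTo n h ≡ sumUpTo n h′
sumUpTo-cong zero    eq = refl
sumUpTo-cong (suc n) eq = cong₂ _+_ (eq (s≤s z≤n)) (sumUpTo-cong n (eq ∘ s≤s))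

sumUpTo-+ : ∀ m n (h : ℕ → ℤ) → sumUpTo (m ℕ.+ n) h ≡ sumUpTo m h + sumUpTo n (h ∘ (m ℕ.+_))
sumUpTo-+ zero    n h = sym (ℤP.+-identityˡ _)
sumUpTo-+ (suc m) n h = trans (cong (λ t → h 0 + t) (sumUpTo-+ m n (h ∘ suc))) (sym (ℤP.+-assoc (h 0) _ _))

sumUpTo-periodic : ∀ g m (h : ℕ → ℤ) → (∀ i → h (m ℕ.+ i) ≡ h i) → sumUpTo (g ℕ.* m) h ≡ + g * sumUpTo m h
sumUpTo-periodic zero    m h period = refl
sumUpTo-periodic (suc g) m h period = begin
  sumUpTo (m ℕ.+ g ℕ.* m) h                      ≡⟨ sumUpTo-+ m (g ℕ.* m) h ⟩
  sumUpTo m h + sumUpTo (g ℕ.* m) (h ∘ (m ℕ.+_)) ≡⟨ cong (λ t → sumUpTo m h + t) (sumUpTo-cong (g ℕ.* m) (λ {i} _ → period i)) ⟩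
  sumUpTo m h + sumUpTo (g ℕ.* m) h              ≡⟨ cong (λ t → sumUpTo m h + t) (sumUpTo-periodic g m h period) ⟩
  sumUpTo m h + + g * sumUpTo m h                ≡⟨ lemma (sumUpTo m h) (+ g) ⟩
  (+ 1 + + g) * sumUpTo m h                      ∎
  where
  open ≡-Reasoning
  lemma : ∀ (v n : ℤ) → v + n * v ≡ (+ 1 + n) * v
  lemma = solve-∀

sumUpTo-const : ∀ n (v : ℤ) → sumUpTo n (λ _ → v) ≡ + n * v
sumUpTo-const n v = begin
  sumUpTo n (λ _ → v)        ≡⟨ cong (λ m → sumUpTo m (λ _ → v)) (ℕP.*-identityʳ n) ⟨
  sumUpTo (n ℕ.* 1) (λ _ → v) ≡⟨ sumUpTo-periodic n 1 (λ _ → v) (λ _ → refl) ⟩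
  + n * (v + + 0)             ≡⟨ cong (λ t → + n * t) (ℤP.+-identityʳ v) ⟩
  + n * v                     ∎
  where open ≡-Reasoning

injective⇒surjective : ∀ {n} {π : Fin n → Fin n} → Injective _≡_ _≡_ π → ∀ y → ∃ λ i → π i ≡ y
injective⇒surjective {suc n} {π} π-inj y with FinP.any? (λ i → π i FinP.≟ y)
... | yes found = found
... | no ¬found = ⊥-elim (ℕP.1+n≰n (FinP.injective⇒≤ ρ-inj))
  where
  y≢π : ∀ i → y ≢ π i
  y≢π i y≡πi = ¬found (i , sym y≡πi)
  -- Missing y, π would squeeze Fin (suc n) injectively into Fin n.
  ρ : Fin (suc n) → Fin n
  ρ i = punchOut (y≢π i)
  ρ-inj : Injective _≡_ _≡_ ρ
  ρ-inj {i} {j} eq = π-inj (FinP.punchOut-injective (y≢π i) (y≢π j) eq)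

sum-toℕ : ∀ n (h : ℕ → ℤ) → sum {n} (h ∘ toℕ) ≡ sumUpTo n h
sum-toℕ zero    h = refl
sum-toℕ (suc n) h = cong (λ t → h 0 + t) (sum-toℕ n (h ∘ suc))

sumUpTo-reindex : ∀ n (σ : ℕ → ℕ) (h : ℕ → ℤ) →
                  (σ< : ∀ {i} → i ℕ.< n → σ i ℕ.< n) →
                  (∀ {i j} → i ℕ.< n → j ℕ.< n → σ i ≡ σ j → i ≡ j) →
                  sumUpTo n (h ∘ σ) ≡ sumUpTo n h
sumUpTo-reindex n σ h σ< σ-inj = begin
  sumUpTo n (h ∘ σ)         ≡⟨ sum-toℕ n (h ∘ σ) ⟨
  sum {n} (h ∘ σ ∘ toℕ)     ≡⟨ sum-cong-≗ {n} (λ i → cong h (FinP.toℕ-fromℕ< (σ< (FinP.toℕ<n i)))) ⟨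
  sum {n} (h ∘ toℕ ∘ π)     ≡⟨ sum-permute (h ∘ toℕ) perm ⟨
  sum {n} (h ∘ toℕ)         ≡⟨ sum-toℕ n h ⟩
  sumUpTo n h               ∎
  where
  open ≡-Reasoning
  π : Fin n → Fin n
  π i = fromℕ< (σ< (FinP.toℕ<n i))
  π-inj : Injective _≡_ _≡_ π
  π-inj {i} {j} eq = FinP.toℕ-injective (σ-inj (FinP.toℕ<n i) (FinP.toℕ<n j) (begin
    σ (toℕ i)   ≡⟨ FinP.toℕ-fromℕ< (σ< (FinP.toℕ<n i)) ⟨
    toℕ (π i)   ≡⟨ cong toℕ eq ⟩
    toℕ (π j)   ≡⟨ FinP.toℕ-fromℕ< (σ< (FinP.toℕ<n j)) ⟩
    σ (toℕ j)   ∎))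
  surj : ∀ j → ∃ λ i → π i ≡ j
  surj = injective⇒surjective π-inj
  perm : Permutation n n
  perm = permutation π (proj₁ ∘ surj) (proj₂ ∘ surj) (λ i → π-inj (proj₂ (surj (π i))))

module _ {P : ℕ → Set} (P? : Decidable P) where
  count-below : ∀ c e (g : ℕ → ℕ) → (∀ {i} → i ℕ.< c → P (g i)) → (∀ i → ¬ P (g (c ℕ.+ i))) →
                length (filter P? (applyUpTo g (c ℕ.+ e))) ≡ c
  count-below zero    e g _   ¬P = cong length (LP.filter-none P? (applyUpTo⁺₂ g e ¬P))
  count-below (suc c) e g P<c ¬P = trans (cong length (LP.filter-accept P? (P<c (s≤s z≤n))))
                                         (cong suc (count-below c e (g ∘ suc) (P<c ∘ s≤s) ¬P))

  count-from : ∀ c e (g : ℕ → ℕ) → (∀ {i} → i ℕ.< c → ¬ P (g i)) → (∀ i → P (g (c ℕ.+ i))) →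
               length (filter P? (applyUpTo g (c ℕ.+ e))) ≡ e
  count-from zero    e g _    P = trans (cong length (LP.filter-all P? (applyUpTo⁺₂ g e P))) (LP.length-applyUpTo g e)
  count-from (suc c) e g ¬P<c P = trans (cong length (LP.filter-reject P? (¬P<c (s≤s z≤n))))
                                        (count-from c e (g ∘ suc) (¬P<c ∘ s≤s) P)

module _ (r s : ℕ) where
  sum-two-valued : ∀ n (h : ℕ → ℤ) → (∀ i → h i ≡ - (+ r) ⊎ h i ≡ + s) →
                   ∃ λ i → ∃ λ j → i ℕ.+ j ≡ n × sumUpTo n h ≡ - (+ r * + j) + + s * + i
  sum-two-valued zero    h _    = 0 , 0 , refl , zero-case (+ r) (+ s)
    where
    zero-case : ∀ (r s : ℤ) → + 0 ≡ - (r * + 0) + s * + 0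
    zero-case = solve-∀
  sum-two-valued (suc n) h vals with sum-two-valued n (h ∘ suc) (vals ∘ suc) | vals 0
  ... | i , j , i+j≡n , eq | inj₁ h0≡-r =
    i , suc j , trans (ℕP.+-suc i j) (cong suc i+j≡n) ,
    trans (cong₂ _+_ h0≡-r eq) (add-r (+ r) (+ s) (+ i) (+ j))
    where
    add-r : ∀ (r s i j : ℤ) → - r + (- (r * j) + s * i) ≡ - (r * (+ 1 + j)) + s * i
    add-r = solve-∀
  ... | i , j , i+j≡n , eq | inj₂ h0≡s =
    suc i , j , cong suc i+j≡n ,
    trans (cong₂ _+_ h0≡s eq) (add-s (+ r) (+ s) (+ i) (+ j))
    where
    add-s : ∀ (r s i j : ℤ) → s + (- (r * j) + s * i) ≡ - (r * j) + s * (+ 1 + i)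
    add-s = solve-∀

  sum-two-valued∈𝒮 : ∀ n (h : ℕ → ℤ) → (∀ i → h i ≡ - (+ r) ⊎ h i ≡ + s) → InS r s n (sumUpTo n h)
  sum-two-valued∈𝒮 n h vals with sum-two-valued n h vals
  ... | i , j , refl , eq = i , ℕP.m≤m+n i j , (begin
    sumUpTo (i ℕ.+ j) h                                   ≡⟨ eq ⟩
    - (+ r * + j) + + s * + i                             ≡⟨ cong₂ (λ x y → - x + y) (ℤP.pos-* r j) (ℤP.pos-* s i) ⟨
    - (+ (r ℕ.* j)) + + (s ℕ.* i)                         ≡⟨ cong (λ x → - (+ (r ℕ.* x)) + + (s ℕ.* i)) (ℕP.m+n∸m≡n i j) ⟨
    - (+ (r ℕ.* (i ℕ.+ j ℕ.∸ i))) + + (s ℕ.* i)           ∎)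
    where open ≡-Reasoning

  𝒮-≤ : ∀ {α n} → InS r s α n → n ℤ.≤ + (s ℕ.* α)
  𝒮-≤ {α} (i , i≤α , refl) = ℤP.+-mono-≤ (ℤP.neg-≤-pos {r ℕ.* (α ℕ.∸ i)}) (ℤ.+≤+ (ℕP.*-monoʳ-≤ s i≤α))

  >-∉𝒮 : ∀ {α n} → s ℕ.* α ℕ.< n → ¬ InS r s α (+ n)
  >-∉𝒮 sα<n n∈𝒮 = ℕP.<⇒≱ sα<n (ℤP.drop‿+≤+ (𝒮-≤ n∈𝒮))

  zero-prefix⇒sum∈𝒮 : ∀ k α (h : ℕ → ℤ) → (∀ i → h i ≡ - (+ r) ⊎ h i ≡ + s) →
                      sumUpTo k h ≡ + 0 → InS r s α (sumUpTo (k ℕ.+ α) h)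
  zero-prefix⇒sum∈𝒮 k α h vals prefix≡0 =
    subst (InS r s α) (sym sum≡tail) (sum-two-valued∈𝒮 α (h ∘ (k ℕ.+_)) (vals ∘ (k ℕ.+_)))
    where
    sum≡tail : sumUpTo (k ℕ.+ α) h ≡ sumUpTo α (h ∘ (k ℕ.+_))
    sum≡tail = begin
      sumUpTo (k ℕ.+ α) h                          ≡⟨ sumUpTo-+ k α h ⟩
      sumUpTo k h + sumUpTo α (h ∘ (k ℕ.+_))       ≡⟨ cong (_+ sumUpTo α (h ∘ (k ℕ.+_))) prefix≡0 ⟩
      + 0 + sumUpTo α (h ∘ (k ℕ.+_))               ≡⟨ ℤP.+-identityˡ _ ⟩
      sumUpTo α (h ∘ (k ℕ.+_))                     ∎
      where open ≡-Reasoning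

module _ (a : ℕ) .{{_ : NonZero a}} where
  residue-unique : ∀ {u v} → u ℕ.< a → v ℕ.< a → + a ℤ∣.∣ + u - + v → u ≡ v
  residue-unique {u} {v} u<a v<a a∣u-v =
    ℤP.+-injective (ℤP.i-j≡0⇒i≡j (+ u) (+ v) (ℤP.∣i∣≡0⇒i≡0 (small-multiple (ℤ∣.∣⇒∣ᵤ a∣u-v) dist<a)))
    where
    dist<a : ℤ.∣ + u - + v ∣ ℕ.< a
    dist<a = begin-strict
      ℤ.∣ + u - + v ∣ ≡⟨ cong ℤ.∣_∣ (ℤP.[+m]-[+n]≡m⊖n u v) ⟩
      ℤ.∣ u ℤ.⊖ v ∣   ≤⟨ ℤP.∣m⊝n∣≤m⊔n u v ⟩
      u ℕ.⊔ v         <⟨ ℕP.⊔-mono-< u<a v<a ⟩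
      a ℕ.⊔ a         ≡⟨ ℕP.⊔-idem a ⟩
      a               ∎
      where open ℕP.≤-Reasoning
    small-multiple : ∀ {n} → a ∣ n → n ℕ.< a → n ≡ 0
    small-multiple {zero}  _   _   = refl
    small-multiple {suc n} a∣n n<a = ⊥-elim (ℕP.<⇒≱ n<a (ℕ∣.∣⇒≤ a∣n))

  %ℕ-≡⇒∣ : ∀ y z → y %ℕ a ≡ z %ℕ a → + a ℤ∣.∣ y - z
  %ℕ-≡⇒∣ y z eq = ℤ∣.divides (y /ℕ a - z /ℕ a) (begin
    y - z
      ≡⟨ cong₂ _-_ (a≡a%ℕn+[a/ℕn]*n y a) (a≡a%ℕn+[a/ℕn]*n z a) ⟩
    (+ (y %ℕ a) + y /ℕ a * + a) - (+ (z %ℕ a) + z /ℕ a * + a)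
      ≡⟨ cong (λ t → (+ (y %ℕ a) + y /ℕ a * + a) - (+ t + z /ℕ a * + a)) eq ⟨
    (+ (y %ℕ a) + y /ℕ a * + a) - (+ (y %ℕ a) + z /ℕ a * + a)
      ≡⟨ lemma (+ (y %ℕ a)) (y /ℕ a) (z /ℕ a) (+ a) ⟩
    (y /ℕ a - z /ℕ a) * + a ∎)
    where
    open ≡-Reasoning
    lemma : ∀ (ρ q q′ a : ℤ) → (ρ + q * a) - (ρ + q′ * a) ≡ (q - q′) * a
    lemma = solve-∀

  ∣⇒%ℕ-≡ : ∀ y z → + a ℤ∣.∣ y - z → y %ℕ a ≡ z %ℕ a
  ∣⇒%ℕ-≡ y z a∣y-z = residue-unique (n%ℕd<d y a) (n%ℕd<d z a)
    (subst (+ a ℤ∣.∣_) remainders (ℤ∣.∣m∣n⇒∣m-n a∣y-z (ℤ∣.∣n⇒∣m*n (y /ℕ a - z /ℕ a) ℤ∣.∣-refl)))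
    where
    open ≡-Reasoning
    lemma : ∀ (ρ ρ′ q q′ a : ℤ) → ((ρ + q * a) - (ρ′ + q′ * a)) - (q - q′) * a ≡ ρ - ρ′
    lemma = solve-∀
    remainders : (y - z) - (y /ℕ a - z /ℕ a) * + a ≡ + (y %ℕ a) - + (z %ℕ a)
    remainders = begin
      (y - z) - (y /ℕ a - z /ℕ a) * + a
        ≡⟨ cong₂ (λ y′ z′ → (y′ - z′) - (y /ℕ a - z /ℕ a) * + a) (a≡a%ℕn+[a/ℕn]*n y a) (a≡a%ℕn+[a/ℕn]*n z a) ⟩
      ((+ (y %ℕ a) + y /ℕ a * + a) - (+ (z %ℕ a) + z /ℕ a * + a)) - (y /ℕ a - z /ℕ a) * + a
        ≡⟨ lemma (+ (y %ℕ a)) (+ (z %ℕ a)) (y /ℕ a) (z /ℕ a) (+ a) ⟩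
      + (y %ℕ a) - + (z %ℕ a) ∎

  %ℕ-periodic : ∀ y w → (y + w * + a) %ℕ a ≡ y %ℕ a
  %ℕ-periodic y w = ∣⇒%ℕ-≡ (y + w * + a) y (ℤ∣.divides w (lemma y w (+ a)))
    where
    lemma : ∀ (y w a : ℤ) → (y + w * a) - y ≡ w * a
    lemma = solve-∀

  affine-%ℕ-injective : ∀ x d → Coprime a ℤ.∣ d ∣ → ∀ {i j} → i ℕ.< a → j ℕ.< a →
                        (x + + i * d) %ℕ a ≡ (x + + j * d) %ℕ a → i ≡ j
  affine-%ℕ-injective x d coprime {i} {j} i<a j<a eq = residue-unique i<a j<a (ℤ∣.∣ᵤ⇒∣ a∣i-j)
    where
    lemma : ∀ (x i j d : ℤ) → (x + i * d) - (x + j * d) ≡ (i - j) * d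
    lemma = solve-∀
    a∣[i-j]d : + a ℤ∣.∣ (+ i - + j) * d
    a∣[i-j]d = subst (+ a ℤ∣.∣_) (lemma x (+ i) (+ j) d) (%ℕ-≡⇒∣ (x + + i * d) (x + + j * d) eq)
    a∣i-j : a ∣ ℤ.∣ + i - + j ∣
    a∣i-j = coprime-divisor coprime
      (subst (a ∣_) (trans (ℤP.abs-* (+ i - + j) d) (ℕP.*-comm _ ℤ.∣ d ∣)) (ℤ∣.∣⇒∣ᵤ a∣[i-j]d))

  sum-affine-coprime : ∀ x d (G : ℕ → ℤ) → Coprime a ℤ.∣ d ∣ →
                       sumUpTo a (λ i → G ((x + + i * d) %ℕ a)) ≡ sumUpTo a G
  sum-affine-coprime x d G coprime =
    sumUpTo-reindex a (λ i → (x + + i * d) %ℕ a) G (λ {i} _ → n%ℕd<d (x + + i * d) a) (affine-%ℕ-injective x d coprime)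

  sum-affine-common-divisor : ∀ x d (G : ℕ → ℤ) {p} → p ∣ a → + p ℤ∣.∣ d →
                              + p ℤ∣.∣ sumUpTo a (λ i → G ((x + + i * d) %ℕ a))
  sum-affine-common-divisor x d G {p} (ℕ∣.divides m a≡m*p) (ℤ∣.divides w d≡w*p) =
    subst (+ p ℤ∣.∣_) (sym sum≡p*period) (ℤ∣.∣m⇒∣m*n _ ℤ∣.∣-refl)
    where
    H : ℕ → ℤ
    H i = G ((x + + i * d) %ℕ a)
    lemma : ∀ (x m i w p : ℤ) → x + (m + i) * (w * p) ≡ (x + i * (w * p)) + w * (m * p)
    lemma = solve-∀
    shift : ∀ i → x + + (m ℕ.+ i) * d ≡ (x + + i * d) + w * + a
    shift i = begin
      x + + (m ℕ.+ i) * d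
        ≡⟨ cong₂ (λ t d′ → x + t * d′) (ℤP.pos-+ m i) d≡w*p ⟩
      x + (+ m + + i) * (w * + p)
        ≡⟨ lemma x (+ m) (+ i) w (+ p) ⟩
      (x + + i * (w * + p)) + w * (+ m * + p)
        ≡⟨ cong₂ (λ d′ a′ → (x + + i * d′) + w * a′) (sym d≡w*p) (trans (sym (ℤP.pos-* m p)) (cong +_ (sym a≡m*p))) ⟩
      (x + + i * d) + w * + a ∎
      where open ≡-Reasoning
    periodic : ∀ i → H (m ℕ.+ i) ≡ H i
    periodic i = cong G (trans (cong (_%ℕ a) (shift i)) (%ℕ-periodic (x + + i * d) w))
    sum≡p*period : sumUpTo a H ≡ + p * sumUpTo m H
    sum≡p*period = trans (cong (λ n → sumUpTo n H) (trans a≡m*p (ℕP.*-comm m p))) (sumUpTo-periodic p m H periodic)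

prime-divisor : ∀ n .{{_ : NonZero n}} → n ≢ 1 → ∃ λ p → Prime p × p ∣ n
prime-divisor n n≢1 with factorise n
... | record { factors = [] ; isFactorisation = n≡1 } = ⊥-elim (n≢1 n≡1)
... | record { factors = p ∷ ps ; isFactorisation = n≡p*ps ; factorsPrime = p-prime ∷ _ } =
  p , p-prime , ℕ∣.divides (product ps) (trans n≡p*ps (ℕP.*-comm p (product ps)))

¬coprime⇒prime-common-divisor : ∀ m n .{{_ : NonZero m}} → ¬ Coprime m n → ∃ λ p → Prime p × p ∣ m × p ∣ n
¬coprime⇒prime-common-divisor m n ¬coprime =
  let p , p-prime , p∣gcd = prime-divisor (gcd m n) {{gcd≢0}} (¬coprime ∘ gcd≡1⇒coprime)
  in p , p-prime , ℕ∣.∣-trans p∣gcd (gcd[m,n]∣m m n) , ℕ∣.∣-trans p∣gcd (gcd[m,n]∣n m n)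
  where
  gcd≢0 : NonZero (gcd m n)
  gcd≢0 = ℕ.≢-nonZero (gcd[m,n]≢0 m n (inj₁ (ℕ.≢-nonZero⁻¹ m)))

+≢-+ : ∀ {m n} .{{_ : NonZero n}} → + m ≢ - (+ n)
+≢-+ {n = suc n} ()

module _ (r s k : ℕ) .{{_ : NonZero r}} where
  f-below : ∀ {j} → j ℕ.< thr r s k ℕ.∸ 1 → f r s k j ≡ - (+ r)
  f-below {j} j<t-1 with suc j ℕ.<? thr r s k
  ... | yes _   = refl
  ... | no  j≮t = ⊥-elim (j≮t (suc-< (thr r s k) j<t-1))
    where
    suc-< : ∀ t → j ℕ.< t ℕ.∸ 1 → suc j ℕ.< t
    suc-< (suc t) j<t = s≤s j<t

  f-from : ∀ i → f r s k (thr r s k ℕ.∸ 1 ℕ.+ i) ≡ + s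
  f-from i with suc (thr r s k ℕ.∸ 1 ℕ.+ i) ℕ.<? thr r s k
  ... | no  _   = refl
  ... | yes j<t = ⊥-elim (ℕP.<⇒≱ j<t (ℕP.≤-trans (ℕP.m≤n+m∸n (thr r s k) 1) (s≤s (ℕP.m≤m+n _ i))))

  f-values : ∀ j → f r s k j ≡ - (+ r) ⊎ f r s k j ≡ + s
  f-values j with suc j ℕ.<? thr r s k
  ... | yes _ = inj₁ refl
  ... | no  _ = inj₂ refl

  countF-below : ∀ e → countF r s k (thr r s k ℕ.∸ 1 ℕ.+ e) (- (+ r)) ≡ thr r s k ℕ.∸ 1
  countF-below e = count-below (λ j → f r s k j ℤ.≟ - (+ r)) _ e id f-below
    (λ i f≡-r → +≢-+ (trans (sym (f-from i)) f≡-r))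

  countF-from : ∀ e → countF r s k (thr r s k ℕ.∸ 1 ℕ.+ e) (+ s) ≡ e
  countF-from e = count-from (λ j → f r s k j ℤ.≟ + s) _ e id
    (λ i<c f≡s → +≢-+ (trans (sym f≡s) (f-below i<c))) f-from

  sumUpTo-f : ∀ e → sumUpTo (thr r s k ℕ.∸ 1 ℕ.+ e) (f r s k) ≡ + (thr r s k ℕ.∸ 1) * - (+ r) + + e * + s
  sumUpTo-f e = begin
    sumUpTo (c ℕ.+ e) (f r s k)
      ≡⟨ sumUpTo-+ c e (f r s k) ⟩
    sumUpTo c (f r s k) + sumUpTo e (f r s k ∘ (c ℕ.+_))
      ≡⟨ cong₂ _+_ (sumUpTo-cong c f-below) (sumUpTo-cong e (λ {i} _ → f-from i)) ⟩
    sumUpTo c (λ _ → - (+ r)) + sumUpTo e (λ _ → + s)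
      ≡⟨ cong₂ _+_ (sumUpTo-const c (- (+ r))) (sumUpTo-const e (+ s)) ⟩
    + c * - (+ r) + + e * + s ∎
    where
    open ≡-Reasoning
    c : ℕ
    c = thr r s k ℕ.∸ 1

module _ (r s q α : ℕ) .{{_ : NonZero r}} .{{_ : NonZero s}} .{{_ : NonZero q}} where
  private
    k : ℕ
    k = q ℕ.* (r ℕ.+ s)
    c : ℕ
    c = thr r s k ℕ.∸ 1
    instance
      r+s≢0 : NonZero (r ℕ.+ s)
      r+s≢0 = nz+ r s

  *k/[r+s] : ∀ m → ℕ._/_ (m ℕ.* k) (r ℕ.+ s) ≡ m ℕ.* q
  *k/[r+s] m = trans (cong (λ n → ℕ._/_ n (r ℕ.+ s)) (sym (ℕP.*-assoc m q (r ℕ.+ s)))) (ℕDM.m*n/n≡m (m ℕ.* q) (r ℕ.+ s))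

  thr∸1+1 : c ℕ.+ 1 ≡ s ℕ.* q
  thr∸1+1 rewrite *k/[r+s] s = ℕP.m∸n+n≡m (ℕ.>-nonZero⁻¹ (s ℕ.* q) {{ℕP.m*n≢0 s q}})

  k+α-split : k ℕ.+ α ≡ c ℕ.+ (ℕ._/_ (r ℕ.* k) (r ℕ.+ s) ℕ.+ 1 ℕ.+ α)
  k+α-split = begin
    k ℕ.+ α                            ≡⟨ cong (ℕ._+ α) (distrib q r s) ⟩
    r ℕ.* q ℕ.+ s ℕ.* q ℕ.+ α          ≡⟨ cong (λ t → r ℕ.* q ℕ.+ t ℕ.+ α) thr∸1+1 ⟨
    r ℕ.* q ℕ.+ (c ℕ.+ 1) ℕ.+ α        ≡⟨ regroup (r ℕ.* q) c α ⟩
    c ℕ.+ (r ℕ.* q ℕ.+ 1 ℕ.+ α)        ≡⟨ cong (λ t → c ℕ.+ (t ℕ.+ 1 ℕ.+ α)) (*k/[r+s] r) ⟨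
    c ℕ.+ (ℕ._/_ (r ℕ.* k) (r ℕ.+ s) ℕ.+ 1 ℕ.+ α) ∎
    where
    open ≡-Reasoning
    distrib : ∀ q r s → q ℕ.* (r ℕ.+ s) ≡ r ℕ.* q ℕ.+ s ℕ.* q
    distrib = ℕ-Solver.solve-∀
    regroup : ∀ x c α → x ℕ.+ (c ℕ.+ 1) ℕ.+ α ≡ c ℕ.+ (x ℕ.+ 1 ℕ.+ α)
    regroup = ℕ-Solver.solve-∀

  sumUpTo-f-total : sumUpTo (k ℕ.+ α) (f r s k) ≡ + (r ℕ.+ s ℕ.+ s ℕ.* α)
  sumUpTo-f-total = begin
    sumUpTo (k ℕ.+ α) (f r s k)
      ≡⟨ cong (λ n → sumUpTo n (f r s k)) k+α-split ⟩
    sumUpTo (c ℕ.+ (ℕ._/_ (r ℕ.* k) (r ℕ.+ s) ℕ.+ 1 ℕ.+ α)) (f r s k)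
      ≡⟨ sumUpTo-f r s k _ ⟩
    + c * - (+ r) + + (ℕ._/_ (r ℕ.* k) (r ℕ.+ s) ℕ.+ 1 ℕ.+ α) * + s
      ≡⟨ cong (λ t → + c * - (+ r) + (t + + 1 + + α) * + s) (trans (cong +_ (*k/[r+s] r)) (ℤP.pos-* r q)) ⟩
    + c * - (+ r) + (+ r * + q + + 1 + + α) * + s
      ≡⟨ expand (+ c) (+ r) (+ s) (+ q) (+ α) ⟩
    + c * - (+ r) + + r * (+ s * + q) + + s + + s * + α
      ≡⟨ cong (λ t → + c * - (+ r) + + r * t + + s + + s * + α) (trans (sym (ℤP.pos-* s q)) (cong +_ (sym thr∸1+1))) ⟩
    + c * - (+ r) + + r * (+ c + + 1) + + s + + s * + α
      ≡⟨ cancel (+ c) (+ r) (+ s) (+ α) ⟩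
    + r + + s + + s * + α
      ≡⟨ cong (λ t → + r + + s + t) (ℤP.pos-* s α) ⟨
    + (r ℕ.+ s ℕ.+ s ℕ.* α) ∎
    where
    open ≡-Reasoning
    expand : ∀ (c r s q α : ℤ) → c * - r + (r * q + + 1 + α) * s ≡ c * - r + r * (s * q) + s + s * α
    expand = solve-∀
    cancel : ∀ (c r s α : ℤ) → c * - r + r * (c + + 1) + s + s * α ≡ r + s + s * α
    cancel = solve-∀

  sumUpTo-f∉𝒮 : ¬ InS r s α (sumUpTo (k ℕ.+ α) (f r s k))
  sumUpTo-f∉𝒮 = >-∉𝒮 r s sα<total ∘ subst (InS r s α) sumUpTo-f-total
    where
    sα<total : s ℕ.* α ℕ.< r ℕ.+ s ℕ.+ s ℕ.* α
    sα<total = ℕP.m<n+m (s ℕ.* α) (ℕP.<-≤-trans (ℕ.>-nonZero⁻¹ r) (ℕP.m≤m+n r s))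

  countF-r : countF r s k (k ℕ.+ α) (- (+ r)) ≡ c
  countF-r = subst (λ n → countF r s k n (- (+ r)) ≡ c) (sym k+α-split) (countF-below r s k _)

  countF-s : countF r s k (k ℕ.+ α) (+ s) ≡ ℕ._/_ (r ℕ.* k) (r ℕ.+ s) ℕ.+ 1 ℕ.+ α
  countF-s = subst (λ n → countF r s k n (+ s) ≡ ℕ._/_ (r ℕ.* k) (r ℕ.+ s) ℕ.+ 1 ℕ.+ α)
                   (sym k+α-split) (countF-from r s k _)

progression-sum∉𝒮 : ∀ r s k α .{{_ : NonZero (k ℕ.+ α)}} (G : ℕ → ℤ) → GoodShift r s k α →
                    ¬ InS r s α (sumUpTo (k ℕ.+ α) G) →
                    ∀ x d → ¬ InS r s α (sumUpTo (k ℕ.+ α) (λ i → G ((x + + i * d) %ℕ (k ℕ.+ α))))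
progression-sum∉𝒮 r s k α G good G∉𝒮 x d with coprime? (k ℕ.+ α) ℤ.∣ d ∣
... | yes coprime = G∉𝒮 ∘ subst (InS r s α) (sum-affine-coprime (k ℕ.+ α) x d G coprime)
... | no ¬coprime with ¬coprime⇒prime-common-divisor (k ℕ.+ α) ℤ.∣ d ∣ ¬coprime
...   | p , p-prime , p∣a , p∣d = λ sum∈𝒮 → good p p-prime p∣a _ sum∈𝒮
  (ℤ∣.∣⇒∣ᵤ (sum-affine-common-divisor (k ℕ.+ α) x d G p∣a (ℤ∣.∣ᵤ⇒∣ p∣d)))

lemma4p3 : (r s k α : ℕ) → .{{_ : NonZero r}} → .{{_ : NonZero s}} → .{{_ : NonZero k}}
    → (r ℕ.+ s) ∣ k → GoodShift r s k α
    → let a = k ℕ.+ α in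
      (countF r s k a (- (+ r)) ≡ ℕ._/_ (s ℕ.* k) (r ℕ.+ s) {{nz+ r s}} ℕ.∸ 1
       × countF r s k a (+ s) ≡ ℕ._/_ (r ℕ.* k) (r ℕ.+ s) {{nz+ r s}} ℕ.+ 1 ℕ.+ α)
    × (∀ (x d : ℤ) → d ≢ + 0 → ¬ InS r s α (apSum r s k a {{nz+ k α}} a x d))
    × (∀ (x d : ℤ) → d ≢ + 0 → apSum r s k a {{nz+ k α}} k x d ≢ + 0)
lemma4p3 r s k α (ℕ∣.divides q refl) good =
  (countF-r r s q α , countF-s r s q α) ,
  (λ x d _ → full-sum∉𝒮 x d ∘ subst (InS r s α) (sumℤ-map-upTo a (H x d))) ,
  (λ x d _ prefix≡0 → full-sum∉𝒮 x d (zero-prefix⇒sum∈𝒮 r s k α (H x d) (λ _ → f-values r s k _)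
                                         (trans (sym (sumℤ-map-upTo k (H x d))) prefix≡0)))
  where
  instance
    q≢0 : NonZero q
    q≢0 = ℕP.m*n≢0⇒m≢0 q
    a≢0 : NonZero (k ℕ.+ α)
    a≢0 = nz+ k α
  a : ℕ
  a = k ℕ.+ α
  H : ℤ → ℤ → ℕ → ℤ
  H x d i = f r s k ((x + + i * d) %ℕ a)
  full-sum∉𝒮 : ∀ x d → ¬ InS r s α (sumUpTo a (H x d))
  full-sum∉𝒮 = progression-sum∉𝒮 r s k α (f r s k) good (sumUpTo-f∉𝒮 r s q α)
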